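{- Let $X$ be a set, i.e. for all $x,y:X$ and $p,q:x=y$ we have $p=q$. Let $f:X\to X$ and $I:\prod_{x:X}(f(f(x))=f(x))$. Then $f$ has a splitting. That is, there exist a type $A$, maps $r:X\to A$ and $s:A\to X$, and homotopies $H:\prod_{a:A}(r(s(a))=a)$ and $K:\prod_{x:X}(s(r(x))=f(x))$.
   Context: Intensional Martin-Löf type theory; no extensionality axioms are assumed. -}

module Submission where

-- An idempotent f on a set X splits through its type of
-- fixed points  Fix f = Σ x, f x ≡ x.  The retraction sends x to the fixed
-- point f x (witnessed by idempotence), the section forgets the witness,
-- so s ∘ r = f holds definitionally.  For r ∘ s = id we must identify
-- (f a , I a) with (a , p) for a fixed point (a , p): the first components
-- agree by p, and the second components agree because X is a set, so each
-- f y ≡ y is a proposition.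

open import Level using (Level)
open import Data.Product using (Σ; Σ-syntax; _×_; _,_; proj₁)
open import Data.Product.Properties using (Σ-≡,≡→≡)
open import Relation.Binary.PropositionalEquality using (_≡_; refl; subst)
open import Axiom.UniquenessOfIdentityProofs using (UIP)

Σ-prop-≡ : {a b : Level} {A : Set a} {B : A → Set b} →
           ((x : A) → (p q : B x) → p ≡ q) →
           {x y : A} {u : B x} {v : B y} → x ≡ y →
           _≡_ {A = Σ A B} (x , u) (y , v)
Σ-prop-≡ {B = B} B-prop {u = u} {v = v} x≡y =
  Σ-≡,≡→≡ (x≡y , B-prop _ (subst B x≡y u) v)

Fix : {ℓ : Level} {X : Set ℓ} → (X → X) → Set ℓ
Fix {X = X} f = Σ[ x ∈ X ] f x ≡ x

Fix-≡ : {ℓ : Level} {X : Set ℓ} → UIP X → (f : X → X) →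
        {x y : X} {u : f x ≡ x} {v : f y ≡ y} → x ≡ y →
        _≡_ {A = Fix f} (x , u) (y , v)
Fix-≡ uip f = Σ-prop-≡ (λ x → uip)

theorem3p7 : {ℓ : Level} (X : Set ℓ) → UIP X →
    (f : X → X) → ((x : X) → f (f x) ≡ f x) →
    Σ[ A ∈ Set ℓ ] Σ[ r ∈ (X → A) ] Σ[ s ∈ (A → X) ]
    (((a : A) → r (s a) ≡ a) × ((x : X) → s (r x) ≡ f x))
theorem3p7 X uip f I = Fix f , r , proj₁ , r∘s≡id , (λ x → refl)
  where
  r : X → Fix f
  r x = f x , I x

  r∘s≡id : (a : Fix f) → r (proj₁ a) ≡ a
  r∘s≡id (a , fa≡a) = Fix-≡ uip f fa≡a
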